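{- Let $G$ be a graph and let $\mathcal{P}=\{\mathcal{P}(v)\colon v\in V_G\}$ be a family where each $\mathcal{P}(v)$ is a partition of $N_G(v)$. Then $\gamma(G\circ\mathcal{P})=\gamma_{\rm cer}(G\circ\mathcal{P})$ if and only if the set $\{u\in V_G\colon |\mathcal{P}(u)|\ge 2\}$ is a dominating set of $G$.
   Context: All graphs are finite and simple; $N_G(v)$ is the set of neighbors of $v$. For such a family $\mathcal{P}$, the $\mathcal{P}$-corona $G\circ\mathcal{P}$ is the graph with vertex set $\{(v,1)\colon v\in V_G\}\cup\bigcup_{v\in V_G}\{(v,A)\colon A\in\mathcal{P}(v)\}$ and edge set $\bigcup_{v\in V_G}\{(v,1)(v,A)\colon A\in\mathcal{P}(v)\}\cup\bigcup_{uv\in E_G}\{(v,A)(u,B)\colon u\in A,\ v\in B\}$ (here $A\in\mathcal{P}(v)$, $B\in\mathcal{P}(u)$). A dominating set of a graph $H$ is a set $D\subseteq V_H$ such that every vertex of $V_H-D$ has a neighbor in $D$; $\gamma(H)$ is the minimum cardinality of a dominating set. A certified dominating set of $H$ is a dominating set $D$ such that every vertex in $D$ has either zero or at least two neighbors in $V_H-D$; $\gamma_{\rm cer}(H)$ is its minimum cardinality. -}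

module Defs where

open import Data.Nat using (ℕ; _≤_)
open import Data.Fin using (Fin)
open import Data.Bool using (Bool; true; false; T)
open import Data.Maybe using (Maybe; just; nothing)
open import Data.List using (List; length; filterᵇ; concatMap; map; allFin; _∷_)
open import Data.Product using (Σ; ∃; ∃-syntax; _×_; _,_)
open import Data.Sum using (_⊎_)
open import Data.Empty using (⊥)
open import Relation.Binary.PropositionalEquality using (_≡_; _≢_)
open import Relation.Nullary using (¬_)

-- Generic notions for a graph H given by a vertex type V, an
-- enumeration `enum` of V (listing every vertex exactly once) and an
-- (symmetric) adjacency relation E.  Vertex subsets are V → Bool.

Dominating : {V : Set} → (V → V → Set) → (V → Bool) → Set
Dominating {V} E D = ∀ (v : V) → ¬ T (D v) → ∃[ u ] (E v u × T (D u))

Certified : {V : Set} → (V → V → Set) → (V → Bool) → Set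
Certified {V} E D =
  Dominating E D ×
  (∀ (v : V) → T (D v) →
     (∀ u → E v u → T (D u)) ⊎
     (∃[ u ] ∃[ w ] (u ≢ w × E v u × ¬ T (D u) × E v w × ¬ T (D w))))

card : {V : Set} → List V → (V → Bool) → ℕ
card enum D = length (filterᵇ D enum)

IsMinCard : {V : Set} → List V → ((V → Bool) → Set) → ℕ → Set
IsMinCard {V} enum P k =
  (∃[ D ] (P D × card enum D ≡ k)) × (∀ (D : V → Bool) → P D → k ≤ card enum D)

IsDomNum : {V : Set} → List V → (V → V → Set) → ℕ → Set
IsDomNum enum E = IsMinCard enum (Dominating E)

IsCerDomNum : {V : Set} → List V → (V → V → Set) → ℕ → Set
IsCerDomNum enum E = IsMinCard enum (Certified E)

-- A family P of partitions: P(v) has k v blocks, named by Fin (k v);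
-- c v u is the block of P(v) containing the neighbour u of v (values of
-- c v on non-neighbours are irrelevant).

IsPartitionFamily : (n : ℕ) (adj : Fin n → Fin n → Bool)
  (k : Fin n → ℕ) (c : (v : Fin n) → Fin n → Fin (k v)) → Set
IsPartitionFamily n adj k c =
  ∀ (v : Fin n) (A : Fin (k v)) → ∃[ u ] (T (adj v u) × c v u ≡ A)

-- vertices of G ∘ P : (v , nothing) is (v,1); (v , just A) is (v,A)
CVertex : (n : ℕ) (k : Fin n → ℕ) → Set
CVertex n k = Σ (Fin n) (λ v → Maybe (Fin (k v)))

cEnum : (n : ℕ) (k : Fin n → ℕ) → List (CVertex n k)
cEnum n k = concatMap (λ v → (v , nothing) ∷ map (λ A → (v , just A)) (allFin (k v))) (allFin n)

CEdge : (n : ℕ) (adj : Fin n → Fin n → Bool)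
  (k : Fin n → ℕ) (c : (v : Fin n) → Fin n → Fin (k v)) →
  CVertex n k → CVertex n k → Set
CEdge n adj k c (v , nothing) (u , nothing) = ⊥
CEdge n adj k c (v , nothing) (u , just B) = v ≡ u
CEdge n adj k c (v , just A) (u , nothing) = v ≡ u
CEdge n adj k c (v , just A) (u , just B) = T (adj v u) × c v u ≡ A × c u v ≡ B

DominatingG : (n : ℕ) (adj : Fin n → Fin n → Bool) → (Fin n → Set) → Set
DominatingG n adj S = ∀ (v : Fin n) → S v ⊎ ∃[ u ] (T (adj v u) × S u)

-- The fibre {(v,1)} ∪ {(v,A) : A ∈ P(v)} is the closed neighbourhood of (v,1), so every
-- dominating set of G ∘ P meets each of the n fibres, and the tops (v,1) show γ(G ∘ P) = n.
-- If S = {u : |P(u)| ≥ 2} dominates G, taking (v,1) for v ∈ S and the single block vertex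
-- (v,A) for v ∉ S gives a certified dominating set of size n. Conversely, if γ_cer = n, a
-- minimum certified set D meets every fibre exactly once; for v ∉ S this forces (v,1) ∉ D
-- and (v,A) ∈ D, and if no neighbour of v were in S, then (v,1) would be the only neighbour
-- of (v,A) outside D.

module Submission where

open import Defs
open import Data.Bool using (Bool; true; false; T)
open import Data.Fin using (Fin; zero; suc) renaming (_≟_ to _≟ᶠ_)
open import Data.Fin.Properties using (any?)
open import Data.List using (List; []; _∷_; length; filter; filterᵇ; concatMap; map; allFin; _++_)
open import Data.List.Extrema.Nat using (argmin; argmin-all; f[argmin]≤f[xs])
open import Data.List.Membership.Propositional using (_∈_; lose)
open import Data.List.Membership.Propositional.Properties
  using (∈-allFin; ∈-concatMap⁺; ∈-filter⁺; ∈-map⁺)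
open import Data.List.Properties
  using (length-++; length-map; length-tabulate; filter-++; filter-≐; filter-accept; filter-reject;
         filter-none; filter-all; filter-some)
open import Data.List.Relation.Unary.All as All using (All; []; _∷_; all?)
open import Data.List.Relation.Unary.All.Properties using (all-filter) renaming (map⁺ to All-map⁺)
open import Data.List.Relation.Unary.Any as Any using (here; there; satisfied)
open import Data.Maybe using (just; nothing)
import Data.Maybe.Properties as Maybe
open import Data.Nat using (ℕ; zero; suc; _≤_; _+_; z≤n; s≤s; _≤?_)
open import Data.Nat.ListAction using (sum)
open import Data.Nat.Properties
  using (≤-antisym; ≤-refl; ≤-reflexive; ≤-trans; +-mono-≤; +-cancelʳ-≤; +-cancelˡ-≤)
open import Data.Product using (Σ; ∃; ∃-syntax; _×_; _,_; proj₁; proj₂)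
import Data.Product.Properties as Product
open import Data.Sum as Sum using (_⊎_; inj₁; inj₂)
open import Function using (_∘_)
open import Relation.Binary.Definitions using (DecidableEquality)
open import Relation.Binary.PropositionalEquality
open import Relation.Nullary using (¬_; Dec; yes; no; contradiction)
open import Relation.Nullary.Decidable
  using (map′; _×-dec_; _⊎-dec_; _→-dec_; ¬?; T?; isYes; isNo; fromWitness; toWitness;
         fromWitnessFalse; toWitnessFalse; decidable-stable)

length≤sum : ∀ {ms : List ℕ} → All (1 ≤_) ms → length ms ≤ sum ms
length≤sum []       = z≤n
length≤sum (p ∷ ps) = +-mono-≤ p (length≤sum ps)

sum≤length⇒all≤1 : ∀ {ms : List ℕ} → All (1 ≤_) ms → sum ms ≤ length ms → All (_≤ 1) ms
sum≤length⇒all≤1 []                 _  = []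
sum≤length⇒all≤1 {m ∷ ms} (p ∷ ps) le =
  +-cancelʳ-≤ (length ms) m 1 (≤-trans (+-mono-≤ ≤-refl (length≤sum ps)) le) ∷
  sum≤length⇒all≤1 ps (+-cancelˡ-≤ 1 _ _ (≤-trans (+-mono-≤ p ≤-refl) le))

all≡1⇒sum≡length : ∀ {ms : List ℕ} → All (_≡ 1) ms → sum ms ≡ length ms
all≡1⇒sum≡length []          = refl
all≡1⇒sum≡length (refl ∷ ps) = cong suc (all≡1⇒sum≡length ps)

card-cong : ∀ {V : Set} (xs : List V) {D D′ : V → Bool} →
  (∀ x → D x ≡ D′ x) → card xs D ≡ card xs D′
card-cong xs {D} {D′} D≗D′ = cong length (filter-≐ (T? ∘ D) (T? ∘ D′) (to , from) xs)
  where
  to : ∀ {x} → T (D x) → T (D′ x)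
  to {x} = subst T (D≗D′ x)

  from : ∀ {x} → T (D′ x) → T (D x)
  from {x} = subst T (sym (D≗D′ x))

card-concatMap : ∀ {V W : Set} (f : W → List V) (ws : List W) (D : V → Bool) →
  card (concatMap f ws) D ≡ sum (map (λ w → card (f w) D) ws)
card-concatMap f []       D = refl
card-concatMap f (w ∷ ws) D = begin
  length (filterᵇ D (f w ++ concatMap f ws))
    ≡⟨ cong length (filter-++ (T? ∘ D) (f w) _) ⟩
  length (filterᵇ D (f w) ++ filterᵇ D (concatMap f ws))
    ≡⟨ length-++ (filterᵇ D (f w)) ⟩
  card (f w) D + card (concatMap f ws) D
    ≡⟨ cong (card (f w) D +_) (card-concatMap f ws D) ⟩
  card (f w) D + sum (map (λ w → card (f w) D) ws)
    ∎
  where open ≡-Reasoning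

IsMinCard-unique : ∀ {V : Set} {xs : List V} {P : (V → Bool) → Set} {a b : ℕ} →
  IsMinCard xs P a → IsMinCard xs P b → a ≡ b
IsMinCard-unique ((D , pD , refl) , minD) ((D′ , pD′ , refl) , minD′) =
  ≤-antisym (minD D′ pD′) (minD′ D pD)

CertifiedAt : {V : Set} → (V → V → Set) → (V → Bool) → V → Set
CertifiedAt E D v =
  (∀ u → E v u → T (D u)) ⊎ (∃[ u ] ∃[ w ] (u ≢ w × E v u × ¬ T (D u) × E v w × ¬ T (D w)))

Dominating-resp : ∀ {V : Set} {E : V → V → Set} {D D′ : V → Bool} →
  (∀ x → D x ≡ D′ x) → Dominating E D → Dominating E D′
Dominating-resp D≗D′ dom v v∉D′ with dom v (v∉D′ ∘ subst T (D≗D′ v))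
... | u , vu , u∈D = u , vu , subst T (D≗D′ u) u∈D

Certified-resp : ∀ {V : Set} {E : V → V → Set} {D D′ : V → Bool} →
  (∀ x → D x ≡ D′ x) → Certified E D → Certified E D′
Certified-resp {D = D} {D′} D≗D′ (dom , cer) = Dominating-resp D≗D′ dom , λ v v∈D′ →
  Sum.map (λ closed u vu → to (closed u vu))
          (λ (u , w , u≢w , vu , u∉D , vw , w∉D) → u , w , u≢w , vu , u∉D ∘ from , vw , w∉D ∘ from)
          (cer v (from v∈D′))
  where
  to : ∀ {x} → T (D x) → T (D′ x)
  to {x} = subst T (D≗D′ x)

  from : ∀ {x} → T (D′ x) → T (D x)
  from {x} = subst T (sym (D≗D′ x))

module Enumerated {V : Set} (enum : List V) (complete : ∀ x → x ∈ enum) (_≟_ : DecidableEquality V)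
  where

  ∀? : {Q : V → Set} → (∀ x → Dec (Q x)) → Dec (∀ x → Q x)
  ∀? Q? = map′ (λ all x → All.lookup all (complete x)) (λ q → All.universal q enum) (all? Q? enum)

  ∃? : {Q : V → Set} → (∀ x → Dec (Q x)) → Dec (∃ Q)
  ∃? Q? = map′ satisfied (λ (x , q) → lose (complete x) q) (Any.any? Q? enum)

  update : V → Bool → (V → Bool) → V → Bool
  update x b D y with y ≟ x
  ... | yes _ = b
  ... | no  _ = D y

  subsets : List V → List (V → Bool)
  subsets []       = (λ _ → false) ∷ []
  subsets (x ∷ xs) = concatMap (λ D → update x true D ∷ update x false D ∷ []) (subsets xs)

  subsets-complete : (D : V → Bool) (xs : List V) →
    ∃[ D′ ] (D′ ∈ subsets xs × (∀ {y} → y ∈ xs → D′ y ≡ D y))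
  subsets-complete D [] = _ , here refl , λ ()
  subsets-complete D (x ∷ xs) with subsets-complete D xs
  ... | D′ , D′∈ , agree =
    update x (D x) D′ , ∈-concatMap⁺ _ (Any.map (λ { refl → choice }) D′∈) , agree′
    where
    choice : update x (D x) D′ ∈ (update x true D′ ∷ update x false D′ ∷ [])
    choice with D x
    ... | true  = here refl
    ... | false = there (here refl)

    agree′ : ∀ {y} → y ∈ x ∷ xs → update x (D x) D′ y ≡ D y
    agree′ {y} y∈ with y ≟ x
    ... | yes refl = refl
    agree′ (here refl) | no y≢x = contradiction refl y≢x
    agree′ (there y∈)  | no _   = agree y∈

  minCard-exists : {P : (V → Bool) → Set} → (∀ D → Dec (P D)) →
    (∀ {D D′} → (∀ x → D x ≡ D′ x) → P D → P D′) →
    ∀ {D₀} → P D₀ → ∃ (IsMinCard enum P)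
  minCard-exists {P} P? resp {D₀} pD₀ = card enum Dmin , (Dmin , pDmin , refl) , minimal
    where
    candidates : List (V → Bool)
    candidates = filter P? (subsets enum)

    Dmin : V → Bool
    Dmin = argmin (card enum) D₀ candidates

    pDmin : P Dmin
    pDmin = argmin-all (card enum) pD₀ (all-filter P? (subsets enum))

    minimal : ∀ D → P D → card enum Dmin ≤ card enum D
    minimal D pD with subsets-complete D enum
    ... | D′ , D′∈ , agree =
      ≤-trans (All.lookup (f[argmin]≤f[xs] D₀ candidates) (∈-filter⁺ P? D′∈ (resp (sym ∘ D′≗D) pD)))
        (≤-reflexive (card-cong enum D′≗D))
      where
      D′≗D : ∀ x → D′ x ≡ D x
      D′≗D x = agree (complete x)

  module _ {E : V → V → Set} (E? : ∀ x y → Dec (E x y)) where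

    dominating? : ∀ D → Dec (Dominating E D)
    dominating? D = ∀? (λ v → ¬? (T? (D v)) →-dec ∃? (λ u → E? v u ×-dec T? (D u)))

    certified? : ∀ D → Dec (Certified E D)
    certified? D = dominating? D ×-dec ∀? (λ v → T? (D v) →-dec certifiedAt? D v)
      where
      certifiedAt? : ∀ D v → Dec (CertifiedAt E D v)
      certifiedAt? D v = ∀? (λ u → E? v u →-dec T? (D u)) ⊎-dec
        ∃? (λ u → ∃? (λ w → ¬? (u ≟ w) ×-dec E? v u ×-dec ¬? (T? (D u)) ×-dec E? v w ×-dec ¬? (T? (D w))))

    certifiedNumber-exists : ∃ (IsCerDomNum enum E)
    certifiedNumber-exists =
      minCard-exists certified? Certified-resp {D₀ = λ _ → true} everything-certified
      where
      everything-certified : Certified E (λ _ → true)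
      everything-certified = (λ _ v∉ → contradiction _ v∉) , (λ _ _ → inj₁ _)

2≰⇒Fin-irrelevant : ∀ {m} → ¬ 2 ≤ m → (a b : Fin m) → a ≡ b
2≰⇒Fin-irrelevant {suc zero}    _   zero zero = refl
2≰⇒Fin-irrelevant {suc (suc _)} 2≰m _    _    = contradiction (s≤s (s≤s z≤n)) 2≰m

2≰⇒Fin-inhabited⇒≡1 : ∀ {m} → ¬ 2 ≤ m → Fin m → m ≡ 1
2≰⇒Fin-inhabited⇒≡1 {suc zero}    _   _ = refl
2≰⇒Fin-inhabited⇒≡1 {suc (suc _)} 2≰m _ = contradiction (s≤s (s≤s z≤n)) 2≰m

2≤⇒Fin-distinct : ∀ {m} → 2 ≤ m → Σ (Fin m) λ a → Σ (Fin m) λ b → a ≢ b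
2≤⇒Fin-distinct (s≤s (s≤s _)) = zero , suc zero , λ ()

module Corona (n : ℕ) (adj : Fin n → Fin n → Bool)
  (k : Fin n → ℕ) (c : (v : Fin n) → Fin n → Fin (k v)) where

  V : Set
  V = CVertex n k

  E : V → V → Set
  E = CEdge n adj k c

  enum : List V
  enum = cEnum n k

  top : Fin n → V
  top v = v , nothing

  block : (v : Fin n) → Fin (k v) → V
  block v A = v , just A

  blocks : Fin n → List V
  blocks v = map (block v) (allFin (k v))

  fibre : Fin n → List V
  fibre v = top v ∷ blocks v

  count : (V → Bool) → Fin n → ℕ
  count D v = card (fibre v) D

  block∈blocks : ∀ v A → block v A ∈ blocks v
  block∈blocks v A = ∈-map⁺ (block v) (∈-allFin A)

  enum-complete : ∀ x → x ∈ enum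
  enum-complete (v , nothing) = ∈-concatMap⁺ fibre (lose (∈-allFin v) (here refl))
  enum-complete (v , just A)  = ∈-concatMap⁺ fibre (lose (∈-allFin v) (there (block∈blocks v A)))

  _≟_ : DecidableEquality V
  _≟_ = Product.≡-dec _≟ᶠ_ (Maybe.≡-dec _≟ᶠ_)

  E? : ∀ x y → Dec (E x y)
  E? (v , nothing) (u , nothing) = no λ ()
  E? (v , nothing) (u , just B)  = v ≟ᶠ u
  E? (v , just A)  (u , nothing) = v ≟ᶠ u
  E? (v , just A)  (u , just B)  = T? (adj v u) ×-dec c v u ≟ᶠ A ×-dec c u v ≟ᶠ B

  certifiedNumber-exists : ∃ (IsCerDomNum enum E)
  certifiedNumber-exists = Enumerated.certifiedNumber-exists enum enum-complete _≟_ E?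

  card≡sum-count : ∀ D → card enum D ≡ sum (map (count D) (allFin n))
  card≡sum-count = card-concatMap fibre (allFin n)

  length-counts : ∀ D → length (map (count D) (allFin n)) ≡ n
  length-counts D = trans (length-map (count D) (allFin n)) (length-tabulate (λ v → v))

  dominating⇒1≤count : ∀ {D} → Dominating E D → ∀ v → 1 ≤ count D v
  dominating⇒1≤count {D} dom v with T? (D (top v))
  ... | yes top∈D = filter-some (T? ∘ D) (here top∈D)
  ... | no  top∉D with dom (top v) top∉D
  ...   | (_ , just B) , refl , B∈D = filter-some (T? ∘ D) (there (lose (block∈blocks v B) B∈D))

  dominating⇒n≤card : ∀ {D} → Dominating E D → n ≤ card enum D
  dominating⇒n≤card {D} dom =
    subst₂ _≤_ (length-counts D) (sym (card≡sum-count D))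
      (length≤sum (All-map⁺ (All.universal (dominating⇒1≤count dom) (allFin n))))

  count≡1⇒card≡n : ∀ {D} → (∀ v → count D v ≡ 1) → card enum D ≡ n
  count≡1⇒card≡n {D} count≡1 = begin
    card enum D                        ≡⟨ card≡sum-count D ⟩
    sum (map (count D) (allFin n))     ≡⟨ all≡1⇒sum≡length (All-map⁺ (All.universal count≡1 (allFin n))) ⟩
    length (map (count D) (allFin n))  ≡⟨ length-counts D ⟩
    n                                  ∎
    where open ≡-Reasoning

  dominating∧card≡n⇒count≤1 : ∀ {D} → Dominating E D → card enum D ≡ n → ∀ v → count D v ≤ 1
  dominating∧card≡n⇒count≤1 {D} dom card≡n v = All.lookup all≤1 (∈-map⁺ (count D) (∈-allFin v))
    where
    all≤1 : All (_≤ 1) (map (count D) (allFin n))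
    all≤1 = sum≤length⇒all≤1 (All-map⁺ (All.universal (dominating⇒1≤count dom) (allFin n)))
      (subst₂ _≤_ (card≡sum-count D) (sym (length-counts D)) (≤-reflexive card≡n))

  allBlocks : ∀ {Q : V → Set} {v} → (∀ A → Q (block v A)) → All Q (blocks v)
  allBlocks {v = v} Q-blocks = All-map⁺ (All.universal Q-blocks (allFin (k v)))

  count-top : ∀ {D v} → T (D (top v)) → (∀ A → ¬ T (D (block v A))) → count D v ≡ 1
  count-top {D} {v} top∈D blocks∉D = cong length (begin
    filterᵇ D (top v ∷ blocks v)  ≡⟨ filter-accept (T? ∘ D) top∈D ⟩
    top v ∷ filterᵇ D (blocks v)  ≡⟨ cong (top v ∷_) (filter-none (T? ∘ D) (allBlocks blocks∉D)) ⟩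
    top v ∷ []                    ∎)
    where open ≡-Reasoning

  count-blocks : ∀ {D v} → ¬ T (D (top v)) → (∀ A → T (D (block v A))) → count D v ≡ k v
  count-blocks {D} {v} top∉D blocks∈D = begin
    length (filterᵇ D (top v ∷ blocks v))  ≡⟨ cong length (filter-reject (T? ∘ D) top∉D) ⟩
    length (filterᵇ D (blocks v))          ≡⟨ cong length (filter-all (T? ∘ D) (allBlocks blocks∈D)) ⟩
    length (blocks v)                      ≡⟨ length-map (block v) (allFin (k v)) ⟩
    length (allFin (k v))                  ≡⟨ length-tabulate (λ A → A) ⟩
    k v                                    ∎
    where open ≡-Reasoning

  top∈∧block∈⇒2≤count : ∀ {D v A} → T (D (top v)) → T (D (block v A)) → 2 ≤ count D v
  top∈∧block∈⇒2≤count {D} {v} {A} top∈D block∈D =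
    subst (2 ≤_) (sym (cong length (filter-accept (T? ∘ D) top∈D)))
      (s≤s (filter-some (T? ∘ D) (lose (block∈blocks v A) block∈D)))

  tops : V → Bool
  tops (_ , nothing) = true
  tops (_ , just _)  = false

  tops-dominating : Dominating E tops
  tops-dominating (v , nothing) top∉ = contradiction _ top∉
  tops-dominating (v , just _)  _    = top v , refl , _

  dominationNumber≡n : IsDomNum enum E n
  dominationNumber≡n =
    (tops , tops-dominating , count≡1⇒card≡n (λ v → count-top {tops} {v} _ (λ _ ()))) ,
    λ _ → dominating⇒n≤card

  module Certificate (bigDominating : DominatingG n adj (λ u → 2 ≤ k u)) where

    certificate : V → Bool
    certificate (v , nothing) = isYes (2 ≤? k v)
    certificate (v , just _)  = isNo (2 ≤? k v)

    certificate-dominating : Dominating E certificate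
    certificate-dominating (v , nothing) top∉ =
      block v (c v v) , refl , fromWitnessFalse (top∉ ∘ fromWitness)
    certificate-dominating (v , just _)  blk∉ =
      top v , refl , fromWitness (decidable-stable (2 ≤? k v) (blk∉ ∘ fromWitnessFalse))

    certificate-certified : Certified E certificate
    certificate-certified = certificate-dominating , certified
      where
      certified : ∀ x → T (certificate x) → CertifiedAt E certificate x
      certified (v , nothing) top∈ with 2≤⇒Fin-distinct (toWitness top∈)
      ... | a , b , a≢b = inj₂ (block v a , block v b , (λ { refl → a≢b refl }) ,
        refl , block∉ {a} , refl , block∉ {b})
        where
        block∉ : ∀ {B} → ¬ T (certificate (block v B))
        block∉ blk∈ = toWitnessFalse blk∈ (toWitness top∈)
      certified (v , just A) blk∈ with bigDominating v
      ... | inj₁ big = contradiction big (toWitnessFalse blk∈)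
      ... | inj₂ (u , vu , big) = inj₂ (top v , block u (c u v) , (λ ()) ,
        refl , small ∘ toWitness ,
        (vu , 2≰⇒Fin-irrelevant small (c v u) A , refl) , (λ blk∈′ → toWitnessFalse blk∈′ big))
        where
        small : ¬ 2 ≤ k v
        small = toWitnessFalse blk∈

    count-certificate : ∀ v → count certificate v ≡ 1
    count-certificate v = byCases (2 ≤? k v)
      where
      byCases : Dec (2 ≤ k v) → count certificate v ≡ 1
      byCases (yes big)  = count-top {certificate} (fromWitness big) (λ _ blk∈ → toWitnessFalse blk∈ big)
      byCases (no small) =
        trans (count-blocks {certificate} (small ∘ toWitness) (λ _ → fromWitnessFalse small))
              (2≰⇒Fin-inhabited⇒≡1 small (c v v))

    certifiedNumber≡n : IsCerDomNum enum E n
    certifiedNumber≡n =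
      (certificate , certificate-certified , count≡1⇒card≡n count-certificate) ,
      λ _ cer → dominating⇒n≤card (proj₁ cer)

  module MinimumCertified {D : V → Bool} (cer : Certified E D) (card≡n : card enum D ≡ n)
    where

    top∈⇒block∉ : ∀ {v A} → T (D (top v)) → ¬ T (D (block v A))
    top∈⇒block∉ {v} top∈ blk∈
      with ≤-trans (top∈∧block∈⇒2≤count {D} top∈ blk∈) (dominating∧card≡n⇒count≤1 (proj₁ cer) card≡n v)
    ... | s≤s ()

    small⇒top∉ : ∀ {w} → ¬ 2 ≤ k w → ¬ T (D (top w))
    small⇒top∉ {w} small top∈ with proj₂ cer (top w) top∈
    ... | inj₁ closed = top∈⇒block∉ top∈ (closed (block w (c w w)) refl)
    ... | inj₂ ((_ , nothing) , _ , _ , () , _)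
    ... | inj₂ ((_ , just _) , (_ , nothing) , _ , _ , _ , () , _)
    ... | inj₂ ((_ , just a) , (_ , just b) , a≢b , refl , _ , refl , _) =
      a≢b (cong (block w) (2≰⇒Fin-irrelevant small a b))

    small⇒block∈ : ∀ {w} → ¬ 2 ≤ k w → ∀ A → T (D (block w A))
    small⇒block∈ {w} small A with proj₁ cer (top w) (small⇒top∉ small)
    ... | (_ , just B) , refl , B∈ = subst (T ∘ D ∘ block w) (2≰⇒Fin-irrelevant small B A) B∈

    outside-neighbour≡top : ∀ {v A x} → (∀ u → T (adj v u) → ¬ 2 ≤ k u) →
      E (block v A) x → ¬ T (D x) → x ≡ top v
    outside-neighbour≡top {x = _ , nothing} _               refl     _  = refl
    outside-neighbour≡top {x = u , just B}  smallNeighbours (vu , _) x∉ =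
      contradiction (small⇒block∈ (smallNeighbours u vu) B) x∉

    small⇒big-neighbour : ∀ {v} → ¬ 2 ≤ k v → ∃[ u ] (T (adj v u) × 2 ≤ k u)
    small⇒big-neighbour {v} small with any? (λ u → T? (adj v u) ×-dec 2 ≤? k u)
    ... | yes found = found
    ... | no  none  with proj₂ cer (block v (c v v)) (small⇒block∈ small (c v v))
    ...   | inj₁ closed = contradiction (closed (top v) refl) (small⇒top∉ small)
    ...   | inj₂ (x , y , x≢y , vx , x∉ , vy , y∉) =
      contradiction (trans (outside-neighbour≡top smallNeighbours vx x∉)
                           (sym (outside-neighbour≡top smallNeighbours vy y∉))) x≢y
      where
      smallNeighbours : ∀ u → T (adj v u) → ¬ 2 ≤ k u
      smallNeighbours u vu big = none (u , vu , big)

    big-dominating : DominatingG n adj (λ u → 2 ≤ k u)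
    big-dominating v with 2 ≤? k v
    ... | yes big  = inj₁ big
    ... | no small = inj₂ (small⇒big-neighbour small)

theorem2p12 : (n : ℕ) (adj : Fin n → Fin n → Bool) →
    (∀ u v → adj u v ≡ adj v u) → (∀ v → ¬ T (adj v v)) →
    (k : Fin n → ℕ) (c : (v : Fin n) → Fin n → Fin (k v)) →
    IsPartitionFamily n adj k c →
    ((∀ a b → IsDomNum (cEnum n k) (CEdge n adj k c) a →
        IsCerDomNum (cEnum n k) (CEdge n adj k c) b → a ≡ b) →
      DominatingG n adj (λ u → 2 ≤ k u)) ×
    (DominatingG n adj (λ u → 2 ≤ k u) →
      (∀ a b → IsDomNum (cEnum n k) (CEdge n adj k c) a →
        IsCerDomNum (cEnum n k) (CEdge n adj k c) b → a ≡ b))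
theorem2p12 n adj _ _ k c _ = onlyIf , if
  where
  open Corona n adj k c

  onlyIf : (∀ a b → IsDomNum enum E a → IsCerDomNum enum E b → a ≡ b) →
    DominatingG n adj (λ u → 2 ≤ k u)
  onlyIf γ≡γcer with certifiedNumber-exists
  ... | _ , γcer@((_ , cer , refl) , _) =
    MinimumCertified.big-dominating cer (sym (γ≡γcer n _ dominationNumber≡n γcer))

  if : DominatingG n adj (λ u → 2 ≤ k u) →
    ∀ a b → IsDomNum enum E a → IsCerDomNum enum E b → a ≡ b
  if bigDominating a b γ γcer =
    trans (IsMinCard-unique {xs = enum} γ dominationNumber≡n)
          (IsMinCard-unique {xs = enum} (Certificate.certifiedNumber≡n bigDominating) γcer)
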